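{- Let $G$ and $H$ be hypergraphs. If $G\cong_f H$ and $G$ is a graph (a $2$-uniform hypergraph), then $H$ is also a graph.
   Context: A hypergraph $G=(V,X)$ consists of a finite vertex set $V$ and a family $X$ of subsets of $V$ (hyperedges); graphs are the $2$-uniform hypergraphs, i.e., every hyperedge has exactly two vertices. If $G$ has $n$ vertices and $m\ge1$ hyperedges, its vertex-hyperedge incidence matrix $M_G\in\{0,1\}^{n\times m}$ has $(i,j)$ entry $1$ iff vertex $i$ belongs to hyperedge $j$. A doubly stochastic matrix is a square nonnegative matrix whose rows and columns each sum to $1$. $G\cong_f H$ means: either $G$ and $H$ have the same number of vertices and no hyperedges, or there exist doubly stochastic matrices $S_1,S_2$ with $S_1M_G=M_HS_2^t$ and $M_GS_2=S_1^tM_H$.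
   Formalization: The doubly stochastic matrices $S_1,S_2$ witnessing $G\cong_f H$ have rational entries. -}

module Defs where

open import Data.Nat using (ℕ; zero; suc)
open import Data.Fin using (Fin; zero; suc)
open import Data.Fin.Subset using (Subset; _∈_; ∣_∣)
open import Data.Fin.Subset.Properties using (_∈?_)
open import Data.Rational using (ℚ; 0ℚ; 1ℚ; _+_; _*_; _≤_)
open import Data.Product using (Σ; _×_)
open import Data.Sum using (_⊎_)
open import Relation.Nullary using (does)
open import Data.Bool using (if_then_else_)
open import Relation.Binary.PropositionalEquality using (_≡_)

-- A hypergraph: a vertex set Fin n and a finite family (indexed list, repetitions
-- allowed) of m hyperedges, each a subset of the vertex set.
record Hypergraph : Set where
  field
    n     : ℕ
    m     : ℕ
    edges : Fin m → Subset n
open Hypergraph public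

Mat : ℕ → ℕ → Set
Mat r c = Fin r → Fin c → ℚ

∑ : (k : ℕ) → (Fin k → ℚ) → ℚ
∑ zero    f = 0ℚ
∑ (suc k) f = f zero + ∑ k (λ i → f (suc i))

_·_ : {a b c : ℕ} → Mat a b → Mat b c → Mat a c
_·_ {b = b} A B i j = ∑ b (λ k → A i k * B k j)

_≋_ : {a b : ℕ} → Mat a b → Mat a b → Set
A ≋ B = ∀ i j → A i j ≡ B i j
infix 4 _≋_

transpose : {a b : ℕ} → Mat a b → Mat b a
transpose A i j = A j i

incidence : (G : Hypergraph) → Mat (n G) (m G)
incidence G i j = if does (i ∈? edges G j) then 1ℚ else 0ℚ

DoublyStochastic : {r c : ℕ} → Mat r c → Set
DoublyStochastic {r} {c} S =
  (r ≡ c)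
  × ((i : Fin r) (j : Fin c) → 0ℚ ≤ S i j)
  × ((i : Fin r) → ∑ c (λ j → S i j) ≡ 1ℚ)
  × ((j : Fin c) → ∑ r (λ i → S i j) ≡ 1ℚ)

_≅f_ : Hypergraph → Hypergraph → Set
G ≅f H =
  (n G ≡ n H × m G ≡ 0 × m H ≡ 0)
  ⊎ Σ (Mat (n H) (n G)) (λ S₁ → Σ (Mat (m G) (m H)) (λ S₂ →
      DoublyStochastic S₁ × DoublyStochastic S₂
      × (S₁ · incidence G) ≋ (incidence H · transpose S₂)
      × (incidence G · S₂) ≋ (transpose S₁ · incidence H)))

IsGraph : Hypergraph → Set
IsGraph G = (j : Fin (m G)) → ∣ edges G j ∣ ≡ 2

-- Sum the columns of M_G S₂ = S₁ᵀ M_H. If every hyperedge of G has r vertices,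
-- every column of M_G sums to r and every column of S₂ to 1, so each column of the
-- left side sums to r; every row of S₁ sums to 1, so column j of the right side
-- sums to the size of the j-th hyperedge of H.
module Submission where

open import Defs
open import Algebra.Bundles using (Ring)
open import Data.Nat as ℕ using (ℕ; zero; suc)
open import Data.Nat.Properties using (m<1+n⇒m<n∨m≡n)
open import Data.Fin using (Fin; zero; suc)
open import Data.Fin.Properties using (¬Fin0)
open import Data.Fin.Subset using (Subset; inside; outside; ∣_∣)
open import Data.Fin.Subset.Properties using (_∈?_)
open import Data.Vec using ([]; _∷_)
open import Data.Rational using (ℚ; 0ℚ; 1ℚ; _+_; _*_; _<_)
open import Data.Rational.Properties
  using (+-*-ring; +-identityˡ; *-identityˡ; *-identityʳ; +-mono-<-≤; ≤-refl;
         positive⁻¹; <-trans; <⇒≢)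
open import Algebra.Properties.Semiring.Sum (Ring.semiring +-*-ring)
  using (sum; sum-cong-≗; ∑-comm; *-distribˡ-sum; *-distribʳ-sum)
open import Algebra.Properties.Semiring.Mult (Ring.semiring +-*-ring) using (_×_)
open import Data.Product using (_,_)
open import Data.Sum using (inj₁; inj₂)
open import Data.Bool using (if_then_else_)
open import Relation.Nullary using (does; contradiction)
open import Relation.Binary.Definitions using (tri<; tri≈; tri>)
open import Relation.Binary.PropositionalEquality
open ≡-Reasoning

×1ℚ-<-suc : ∀ k → k × 1ℚ < suc k × 1ℚ
×1ℚ-<-suc k = subst (_< suc k × 1ℚ) (+-identityˡ (k × 1ℚ))
  (+-mono-<-≤ (positive⁻¹ 1ℚ) (≤-refl {k × 1ℚ}))

×1ℚ-strictMono : ∀ {m n} → m ℕ.< n → m × 1ℚ < n × 1ℚ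
×1ℚ-strictMono {m} {suc n} m<1+n with m<1+n⇒m<n∨m≡n m<1+n
... | inj₁ m<n  = <-trans (×1ℚ-strictMono m<n) (×1ℚ-<-suc n)
... | inj₂ refl = ×1ℚ-<-suc n

×1ℚ-injective : ∀ {m n} → m × 1ℚ ≡ n × 1ℚ → m ≡ n
×1ℚ-injective {m} {n} eq with ℕ.<-cmp m n
... | tri< m<n _ _ = contradiction eq (<⇒≢ (×1ℚ-strictMono m<n))
... | tri≈ _ m≡n _ = m≡n
... | tri> _ _ n<m = contradiction (sym eq) (<⇒≢ (×1ℚ-strictMono n<m))

∑≡sum : ∀ k (f : Fin k → ℚ) → ∑ k f ≡ sum f
∑≡sum zero    f = refl
∑≡sum (suc k) f = cong (f zero +_) (∑≡sum k (λ i → f (suc i)))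

columnSum : ∀ {r c} → Mat r c → Fin c → ℚ
columnSum {r} A j = ∑ r (λ i → A i j)

columnSum-cong : ∀ {r c} {A B : Mat r c} → A ≋ B → ∀ j → columnSum A j ≡ columnSum B j
columnSum-cong {r} {A = A} {B} A≋B j = begin
  ∑ r (λ i → A i j)  ≡⟨ ∑≡sum r _ ⟩
  sum (λ i → A i j)  ≡⟨ sum-cong-≗ (λ i → A≋B i j) ⟩
  sum (λ i → B i j)  ≡⟨ ∑≡sum r _ ⟨
  ∑ r (λ i → B i j)  ∎

columnSum-· : ∀ {a b c} (A : Mat a b) (B : Mat b c) j →
              columnSum (A · B) j ≡ sum (λ k → columnSum A k * B k j)
columnSum-· {a} {b} A B j = begin
  ∑ a (λ i → ∑ b (λ k → A i k * B k j))    ≡⟨ ∑≡sum a _ ⟩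
  sum (λ i → ∑ b (λ k → A i k * B k j))    ≡⟨ sum-cong-≗ (λ i → ∑≡sum b (λ k → A i k * B k j)) ⟩
  sum (λ i → sum (λ k → A i k * B k j))    ≡⟨ ∑-comm (λ i k → A i k * B k j) ⟩
  sum (λ k → sum (λ i → A i k * B k j))    ≡⟨ sum-cong-≗ (λ k → *-distribʳ-sum (B k j) (λ i → A i k)) ⟨
  sum (λ k → sum (λ i → A i k) * B k j)    ≡⟨ sum-cong-≗ (λ k → cong (_* B k j) (∑≡sum a _)) ⟨
  sum (λ k → columnSum A k * B k j)        ∎

columnSum-·-const : ∀ {a b c} (A : Mat a b) (B : Mat b c) {x} →
                    (∀ k → columnSum A k ≡ x) → ∀ j → columnSum (A · B) j ≡ x * columnSum B j
columnSum-·-const {b = b} A B {x} A-columns j = begin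
  columnSum (A · B) j                ≡⟨ columnSum-· A B j ⟩
  sum (λ k → columnSum A k * B k j)  ≡⟨ sum-cong-≗ (λ k → cong (_* B k j) (A-columns k)) ⟩
  sum (λ k → x * B k j)              ≡⟨ *-distribˡ-sum x (λ k → B k j) ⟨
  x * sum (λ k → B k j)              ≡⟨ cong (x *_) (∑≡sum b _) ⟨
  x * columnSum B j                  ∎

∑-indicator : ∀ {n} (p : Subset n) → ∑ n (λ i → if does (i ∈? p) then 1ℚ else 0ℚ) ≡ ∣ p ∣ × 1ℚ
∑-indicator []            = refl
∑-indicator (inside ∷ p)  = cong (1ℚ +_) (∑-indicator p)
∑-indicator (outside ∷ p) = trans (+-identityˡ _) (∑-indicator p)

columnSum-incidence : ∀ G j → columnSum (incidence G) j ≡ ∣ edges G j ∣ × 1ℚ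
columnSum-incidence G j = ∑-indicator (edges G j)

IsUniform : ℕ → Hypergraph → Set
IsUniform r G = ∀ j → ∣ edges G j ∣ ≡ r

≅f-preserves-IsUniform : ∀ {r G H} → G ≅f H → IsUniform r G → IsUniform r H
≅f-preserves-IsUniform (inj₁ (_ , _ , mH≡0)) _ j = contradiction (subst Fin mH≡0 j) ¬Fin0
≅f-preserves-IsUniform {r} {G} {H}
  (inj₂ (S₁ , S₂ , (_ , _ , S₁-rows , _) , (_ , _ , _ , S₂-columns) , _ , MG·S₂≋S₁ᵀ·MH))
  G-uniform j = ×1ℚ-injective (begin
    ∣ edges H j ∣ × 1ℚ                 ≡⟨ columnSum-incidence H j ⟨
    columnSum MH j                     ≡⟨ *-identityˡ _ ⟨
    1ℚ * columnSum MH j                ≡⟨ columnSum-·-const (transpose S₁) MH S₁-rows j ⟨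
    columnSum (transpose S₁ · MH) j    ≡⟨ columnSum-cong MG·S₂≋S₁ᵀ·MH j ⟨
    columnSum (MG · S₂) j              ≡⟨ columnSum-·-const MG S₂ MG-columns j ⟩
    r × 1ℚ * columnSum S₂ j            ≡⟨ cong (r × 1ℚ *_) (S₂-columns j) ⟩
    r × 1ℚ * 1ℚ                        ≡⟨ *-identityʳ _ ⟩
    r × 1ℚ                             ∎)
  where
  MG = incidence G
  MH = incidence H
  MG-columns : ∀ k → columnSum MG k ≡ r × 1ℚ
  MG-columns k = trans (columnSum-incidence G k) (cong (_× 1ℚ) (G-uniform k))

mainTheorem8 : (G H : Hypergraph) → G ≅f H → IsGraph G → IsGraph H
mainTheorem8 G H = ≅f-preserves-IsUniform
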